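{- For every proper subclass $\mathcal M$ of $\mathcal E_3$ that is closed under induced restrictions, there exists $k$ such that $\chi(M)\le k$ for all $M\in\mathcal M$.
   Context: A simple binary matroid (here just "matroid") is a pair $M=(E,G)$, where $G$ is identified with $\mathbb F_2^n\setminus\{0\}$ for some $n\ge0$ and $E\subseteq G$; $\dim(M)=n$. A flat of $G$ is a set $V\setminus\{0\}$ with $V$ a subspace of $\mathbb F_2^n$, of dimension $\dim V$. $N$ is an induced restriction of $M$ if there is an injective linear map $\varphi:G(N)\to G$ (linear on the underlying vector spaces) with $\varphi(E(N))=E\cap\varphi(G(N))$; matroids are considered up to isomorphism (bijective such $\varphi$). The critical number $\chi(M)$ is the smallest $k\ge0$ such that $G\setminus E$ contains a flat of dimension $n-k$. $\mathcal E_3$ is the class of matroids $M=(E,G)$ with $|E\cap F|$ even for every flat $F$ of $G$ of dimension at least $3$. -}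

module Defs where

open import Data.Nat using (ℕ; zero; suc; _+_; _<_; _≤_)
open import Data.Nat.Divisibility using (_∣_)
open import Data.Bool using (Bool; true; false; _xor_; _∨_; _∧_; if_then_else_)
open import Data.Vec using (Vec; []; _∷_; zipWith; replicate)
open import Data.List using (List; _++_; map) renaming ([] to []ₗ; _∷_ to _∷ₗ_)
open import Data.Nat.ListAction using (sum)
open import Data.Product using (Σ; _×_; ∃; _,_)
open import Relation.Nullary using (¬_)
open import Relation.Binary.PropositionalEquality using (_≡_; _≢_)

-- Vectors of F₂ⁿ are Vec Bool n; addition is coordinatewise xor.
𝟘 : (n : ℕ) → Vec Bool n
𝟘 n = replicate n false

_⊕_ : {n : ℕ} → Vec Bool n → Vec Bool n → Vec Bool n
_⊕_ = zipWith _xor_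

isNZ : {n : ℕ} → Vec Bool n → Bool
isNZ []      = false
isNZ (b ∷ x) = b ∨ isNZ x

allVecs : (n : ℕ) → List (Vec Bool n)
allVecs zero    = [] ∷ₗ []ₗ
allVecs (suc n) = map (false ∷_) (allVecs n) ++ map (true ∷_) (allVecs n)

-- Linear maps F₂ᵐ → F₂ⁿ (additivity = linearity over F₂) and injectivity.
IsLinear : {m n : ℕ} → (Vec Bool m → Vec Bool n) → Set
IsLinear f = ∀ x y → f (x ⊕ y) ≡ f x ⊕ f y

IsInjective : {m n : ℕ} → (Vec Bool m → Vec Bool n) → Set
IsInjective f = ∀ x y → f x ≡ f y → x ≡ y

-- An injective linear map F₂ᵈ → F₂ⁿ.  Flats of G = F₂ⁿ∖{0} of dimension d
-- are exactly the sets φ(F₂ᵈ)∖{0} for such φ.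
record Embedding (d n : ℕ) : Set where
  field
    fun    : Vec Bool d → Vec Bool n
    linear : IsLinear fun
    inj    : IsInjective fun
open Embedding public

-- A simple binary matroid M = (E, G), G = F₂ⁿ∖{0}, E ⊆ G given by its
-- characteristic function (with 0 ∉ E).
record Matroid : Set where
  field
    dim   : ℕ
    E     : Vec Bool dim → Bool
    E-0   : E (𝟘 dim) ≡ false
open Matroid public

-- N is an induced restriction of M: injective linear φ : G(N) → G with
-- φ(E(N)) = E ∩ φ(G(N)), i.e. for every nonzero x, x ∈ E(N) ⟺ φ x ∈ E(M).
InducedRestriction : Matroid → Matroid → Set
InducedRestriction N M =
  Σ (Embedding (dim N) (dim M)) λ φ →
    ∀ (x : Vec Bool (dim N)) → x ≢ 𝟘 (dim N) → E N x ≡ E M (fun φ x)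

-- |E ∩ F| for the flat F = φ(F₂ᵈ)∖{0}  (φ injective, so counting preimages).
countOnFlat : (M : Matroid) {d : ℕ} → Embedding d (dim M) → ℕ
countOnFlat M {d} φ =
  sum (map (λ x → if isNZ x ∧ E M (fun φ x) then 1 else 0) (allVecs d))

InE3 : Matroid → Set
InE3 M = ∀ (d : ℕ) → 3 ≤ d → (φ : Embedding d (dim M)) → 2 ∣ countOnFlat M φ

HasFreeFlat : Matroid → ℕ → Set
HasFreeFlat M d =
  Σ (Embedding d (dim M)) λ φ →
    ∀ (x : Vec Bool d) → x ≢ 𝟘 d → E M (fun φ x) ≡ false

-- G ∖ E contains a flat of dimension n − k  (k ≤ n implicit in d + k ≡ n).
CodimFree : Matroid → ℕ → Set
CodimFree M k = Σ ℕ λ d → (d + k ≡ dim M) × HasFreeFlat M d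

IsCriticalNumber : Matroid → ℕ → Set
IsCriticalNumber M c = CodimFree M c × (∀ k → k < c → ¬ CodimFree M k)

MatroidClass : Set₁
MatroidClass = Matroid → Set

ClosedUnderInducedRestriction : MatroidClass → Set
ClosedUnderInducedRestriction 𝓜 =
  ∀ M N → 𝓜 M → InducedRestriction N M → 𝓜 N

ProperSubclassOfE3 : MatroidClass → Set
ProperSubclassOfE3 𝓜 = (∀ M → 𝓜 M → InE3 M) × (Σ Matroid λ M → InE3 M × ¬ 𝓜 M)

-- The indicator f of E is a quadratic function on F₂ⁿ: evenness of |E ∩ F| on the 3-dimensional flats F makes the
-- third derivative of f vanish, so that the polar form f (a ⊕ b) + f a + f b is bilinear. A quadratic function either
-- has R mutually orthogonal hyperbolic pairs (x, y), with polar value 1 on each pair, or vanishes on a flat of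
-- codimension at most 2R + 1: split off the orthogonal complement of one pair and recurse, ending with a linear form,
-- whose kernel has codimension at most 1. Two hyperbolic pairs suffice to add one dimension to an embedding that
-- realizes a prescribed quadratic function: the first pair provides a new generator detected by its partner, the
-- second corrects the value of f on it. So with 2 · dim N pairs every N ∈ 𝓔₃ is an induced restriction of M.
-- Taking N ∈ 𝓔₃ ∖ 𝓜, every M ∈ 𝓜 is in the second case, and χ(M) ≤ 4 · dim N + 1.

module Submission where

open import Defs
open import Algebra.Bundles using (CommutativeRing)
import Algebra.Solver.CommutativeMonoid
open import Data.Bool using (Bool; true; false; _xor_; _∧_; if_then_else_)
import Data.Bool
open import Data.Bool.Properties using (xor-comm; xor-assoc; xor-same; xor-identityʳ; ∧-zeroʳ; ∧-identityʳ; xor-∧-commutativeRing)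
open import Data.Empty using (⊥-elim)
open import Data.Fin using (zero; suc)
open import Data.List using (List; foldr) renaming ([] to []ₗ; _∷_ to _∷ₗ_)
import Data.List as List
open import Data.Nat using (ℕ; zero; suc; _+_; _*_; _≤_; _≤?_; s≤s; z≤n)
open import Data.Nat.Base using (parity)
open import Data.Nat.Divisibility using (_∣_; divides)
open import Data.Nat.ListAction using (sum)
open import Data.Nat.Properties using (+-assoc; +-identityʳ; +-comm; ≤-trans; ≰⇒>)
open import Data.Parity.Base using (0ℙ) renaming (_+_ to _+ℙ_)
open import Data.Parity.Properties using (+-homo-+; *-homo-*; *-zeroʳ)
open import Data.Product using (Σ; ∃; _×_; _,_; proj₁; proj₂)
open import Data.Sum using (_⊎_; inj₁; inj₂)
open import Data.Vec using (Vec; []; _∷_; map)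
open import Data.Vec.Properties using (≡-dec; ∷-injectiveˡ; ∷-injectiveʳ)
open import Data.Vec.Relation.Unary.All using (All; []; _∷_)
import Data.Vec.Relation.Unary.All as All
open import Data.Vec.Relation.Unary.All.Properties using (map⁺)
open import Relation.Binary.Definitions using (DecidableEquality)
open import Relation.Binary.PropositionalEquality
open import Relation.Nullary using (yes; no)

-- Linear algebra over F₂

V : ℕ → Set
V = Vec Bool

true≢false : true ≢ false
true≢false ()

xor≡false⇒≡ : ∀ {a b} → a xor b ≡ false → a ≡ b
xor≡false⇒≡ {false} {false} _ = refl
xor≡false⇒≡ {true}  {true}  _ = refl

false-or-true : ∀ b → b ≡ false ⊎ b ≡ true
false-or-true false = inj₁ refl
false-or-true true  = inj₂ refl

⊕-comm : ∀ {n} (a b : V n) → a ⊕ b ≡ b ⊕ a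
⊕-comm []      []      = refl
⊕-comm (x ∷ a) (y ∷ b) = cong₂ _∷_ (xor-comm x y) (⊕-comm a b)

⊕-assoc : ∀ {n} (a b c : V n) → (a ⊕ b) ⊕ c ≡ a ⊕ (b ⊕ c)
⊕-assoc []      []      []      = refl
⊕-assoc (x ∷ a) (y ∷ b) (z ∷ c) = cong₂ _∷_ (xor-assoc x y z) (⊕-assoc a b c)

⊕-identityˡ : ∀ {n} (a : V n) → 𝟘 n ⊕ a ≡ a
⊕-identityˡ []      = refl
⊕-identityˡ (x ∷ a) = cong (x ∷_) (⊕-identityˡ a)

⊕-identityʳ : ∀ {n} (a : V n) → a ⊕ 𝟘 n ≡ a
⊕-identityʳ a = trans (⊕-comm a _) (⊕-identityˡ a)

⊕-same : ∀ {n} (a : V n) → a ⊕ a ≡ 𝟘 n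
⊕-same []      = refl
⊕-same (x ∷ a) = cong₂ _∷_ (xor-same x) (⊕-same a)

⊕-cancelˡ : ∀ {n} (a b : V n) → a ⊕ (a ⊕ b) ≡ b
⊕-cancelˡ a b = begin
  a ⊕ (a ⊕ b)  ≡⟨ ⊕-assoc a a b ⟨
  (a ⊕ a) ⊕ b  ≡⟨ cong (_⊕ b) (⊕-same a) ⟩
  𝟘 _ ⊕ b      ≡⟨ ⊕-identityˡ b ⟩
  b            ∎
  where open ≡-Reasoning

⊕-cancelʳ : ∀ {n} (a b : V n) → (a ⊕ b) ⊕ b ≡ a
⊕-cancelʳ a b = trans (⊕-assoc a b b) (trans (cong (a ⊕_) (⊕-same b)) (⊕-identityʳ a))

⊕-injectiveˡ : ∀ {n} (a : V n) {b c} → a ⊕ b ≡ a ⊕ c → b ≡ c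
⊕-injectiveˡ a {b} {c} eq = trans (sym (⊕-cancelˡ a b)) (trans (cong (a ⊕_) eq) (⊕-cancelˡ a c))

⊕≡𝟘⇒≡ : ∀ {n} {a b : V n} → a ⊕ b ≡ 𝟘 n → a ≡ b
⊕≡𝟘⇒≡ {a = a} {b} eq = ⊕-injectiveˡ a (trans (⊕-same a) (sym eq))

⊕-interchange : ∀ {n} (a b c d : V n) → (a ⊕ b) ⊕ (c ⊕ d) ≡ (a ⊕ c) ⊕ (b ⊕ d)
⊕-interchange a b c d = begin
  (a ⊕ b) ⊕ (c ⊕ d)  ≡⟨ ⊕-assoc a b (c ⊕ d) ⟩
  a ⊕ (b ⊕ (c ⊕ d))  ≡⟨ cong (a ⊕_) (⊕-assoc b c d) ⟨
  a ⊕ ((b ⊕ c) ⊕ d)  ≡⟨ cong (λ t → a ⊕ (t ⊕ d)) (⊕-comm b c) ⟩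
  a ⊕ ((c ⊕ b) ⊕ d)  ≡⟨ cong (a ⊕_) (⊕-assoc c b d) ⟩
  a ⊕ (c ⊕ (b ⊕ d))  ≡⟨ ⊕-assoc a c (b ⊕ d) ⟨
  (a ⊕ c) ⊕ (b ⊕ d)  ∎
  where open ≡-Reasoning

infixr 30 _·_
_·_ : ∀ {n} → Bool → V n → V n
true  · v = v
false · v = 𝟘 _

·-distribʳ-xor : ∀ {n} s t (v : V n) → (s xor t) · v ≡ s · v ⊕ t · v
·-distribʳ-xor true  true  v = sym (⊕-same v)
·-distribʳ-xor true  false v = sym (⊕-identityʳ v)
·-distribʳ-xor false t     v = sym (⊕-identityˡ (t · v))

IsLinearForm : ∀ {n} → (V n → Bool) → Set
IsLinearForm ℓ = ∀ u v → ℓ (u ⊕ v) ≡ ℓ u xor ℓ v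

linearForm-𝟘 : ∀ {n} (ℓ : V n → Bool) → IsLinearForm ℓ → ℓ (𝟘 n) ≡ false
linearForm-𝟘 {n} ℓ lin = trans (cong ℓ (sym (⊕-same (𝟘 n)))) (trans (lin _ _) (xor-same (ℓ (𝟘 n))))

linear-𝟘 : ∀ {m n} (φ : V m → V n) → IsLinear φ → φ (𝟘 m) ≡ 𝟘 n
linear-𝟘 {m} φ lin = trans (cong φ (sym (⊕-same (𝟘 m)))) (trans (lin _ _) (⊕-same _))

_∘ₑ_ : ∀ {a b c} → Embedding b c → Embedding a b → Embedding a c
ψ ∘ₑ φ = record
  { fun    = λ u → fun ψ (fun φ u)
  ; linear = λ u v → trans (cong (fun ψ) (linear φ u v)) (linear ψ _ _)
  ; inj    = λ u v eq → inj φ u v (inj ψ _ _ eq)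
  }

idₑ : ∀ {n} → Embedding n n
idₑ = record { fun = λ u → u ; linear = λ _ _ → refl ; inj = λ _ _ eq → eq }

linearForm-· : ∀ {n} (ℓ : V n → Bool) → IsLinearForm ℓ → ∀ s a → ℓ (s · a) ≡ s ∧ ℓ a
linearForm-· ℓ lin true  a = refl
linearForm-· ℓ lin false a = linearForm-𝟘 ℓ lin

linearForm-·⊕ : ∀ {n} (ℓ : V n → Bool) → IsLinearForm ℓ → ∀ s a b → ℓ (s · a ⊕ b) ≡ (s ∧ ℓ a) xor ℓ b
linearForm-·⊕ ℓ lin s a b = trans (lin (s · a) b) (cong (_xor ℓ b) (linearForm-· ℓ lin s a))

trivialKernel⇒injective : ∀ {m n} (φ : V m → V n) → IsLinear φ → (∀ v → φ v ≡ 𝟘 n → v ≡ 𝟘 m) → IsInjective φ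
trivialKernel⇒injective φ lin ker u v eq =
  ⊕≡𝟘⇒≡ (ker (u ⊕ v) (trans (lin u v) (trans (cong (φ u ⊕_) (sym eq)) (⊕-same (φ u)))))

∀-or-∃ : ∀ {n} {P Q : V n → Set} → (∀ v → P v ⊎ Q v) → (∀ v → P v) ⊎ ∃ Q
∀-or-∃ {zero} decide with decide []
... | inj₁ p = inj₁ λ { [] → p }
... | inj₂ q = inj₂ ([] , q)
∀-or-∃ {suc n} decide
  with ∀-or-∃ (λ v → decide (false ∷ v)) | ∀-or-∃ (λ v → decide (true ∷ v))
... | inj₂ (v , q) | _            = inj₂ (false ∷ v , q)
... | inj₁ _       | inj₂ (v , q) = inj₂ (true ∷ v , q)
... | inj₁ p₀      | inj₁ p₁      = inj₁ λ { (false ∷ v) → p₀ v ; (true ∷ v) → p₁ v }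

infix 4 _≟_
_≟_ : ∀ {n} → DecidableEquality (V n)
_≟_ = ≡-dec Data.Bool._≟_

e₀ : ∀ {n} → V (suc n)
e₀ = true ∷ 𝟘 _

·e₀⊕ : ∀ {n} s (u : V n) → s · e₀ ⊕ (false ∷ u) ≡ s ∷ u
·e₀⊕ true  u = cong (true ∷_) (⊕-identityˡ u)
·e₀⊕ false u = cong (false ∷_) (⊕-identityˡ u)

linearForm-∷ : ∀ {n} (ℓ : V (suc n) → Bool) → IsLinearForm ℓ → ∀ s u → ℓ (s ∷ u) ≡ (s ∧ ℓ e₀) xor ℓ (false ∷ u)
linearForm-∷ ℓ lin s u = trans (cong ℓ (sym (·e₀⊕ s u))) (linearForm-·⊕ ℓ lin s e₀ (false ∷ u))

extend : ∀ {m n} (φ : Embedding m n) (v : V n) (h : V n → Bool) → IsLinearForm h →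
         (∀ u → h (fun φ u) ≡ false) → h v ≡ true → Embedding (suc m) n
extend {m} {n} φ v h lin h∘φ≡false hv≡true = record { fun = ext ; linear = ext-linear ; inj = ext-injective }
  where
  ext : V (suc m) → V n
  ext (s ∷ u) = s · v ⊕ fun φ u

  ext-linear : IsLinear ext
  ext-linear (s ∷ u) (s′ ∷ u′) = begin
    (s xor s′) · v ⊕ fun φ (u ⊕ u′)          ≡⟨ cong₂ _⊕_ (·-distribʳ-xor s s′ v) (linear φ u u′) ⟩
    (s · v ⊕ s′ · v) ⊕ (fun φ u ⊕ fun φ u′)  ≡⟨ ⊕-interchange (s · v) _ _ _ ⟩
    (s · v ⊕ fun φ u) ⊕ (s′ · v ⊕ fun φ u′)  ∎
    where open ≡-Reasoning

  h∘ext : ∀ s u → h (ext (s ∷ u)) ≡ s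
  h∘ext s u = begin
    h (s · v ⊕ fun φ u)           ≡⟨ linearForm-·⊕ h lin s v (fun φ u) ⟩
    (s ∧ h v) xor h (fun φ u)     ≡⟨ cong₂ (λ x y → (s ∧ x) xor y) hv≡true (h∘φ≡false u) ⟩
    (s ∧ true) xor false          ≡⟨ xor-identityʳ (s ∧ true) ⟩
    s ∧ true                      ≡⟨ ∧-identityʳ s ⟩
    s                             ∎
    where open ≡-Reasoning

  ext-injective : IsInjective ext
  ext-injective (s ∷ u) (s′ ∷ u′) eq with trans (sym (h∘ext s u)) (trans (cong h eq) (h∘ext s′ u′))
  ... | refl = cong (s ∷_) (inj φ u u′ (⊕-injectiveˡ (s · v) eq))

record Kernel {n} (ℓ : V (suc n) → Bool) : Set where
  field
    embedding   : Embedding n (suc n)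
    annihilated : ∀ w → ℓ (fun embedding w) ≡ false
    exhaustive  : ∀ z → ℓ z ≡ false → ∃ λ w → fun embedding w ≡ z
open Kernel

-- If ℓ e₀ ≡ true the kernel is the graph of u ↦ ℓ (false ∷ u); otherwise ℓ ignores the first coordinate.
kernel : ∀ {n} (ℓ : V (suc n) → Bool) → IsLinearForm ℓ → ∀ v → ℓ v ≡ true → Kernel ℓ
kernel-tail : ∀ {n} (ℓ : V (suc n) → Bool) → IsLinearForm ℓ → ℓ e₀ ≡ false → ∀ v → ℓ v ≡ true → Kernel ℓ

kernel {n} ℓ lin v ℓv≡true with ℓ e₀ in ℓe₀
... | false = kernel-tail ℓ lin ℓe₀ v ℓv≡true
... | true  = record
  { embedding   = record { fun = graph ; linear = graph-linear ; inj = λ u u′ → ∷-injectiveʳ }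
  ; annihilated = λ w → trans (ℓ-∷ (ℓ₀ w) w) (xor-same (ℓ₀ w))
  ; exhaustive  = λ { (s ∷ u) ℓz≡false → u , cong (_∷ u) (sym (xor≡false⇒≡ (trans (sym (ℓ-∷ s u)) ℓz≡false))) }
  }
  where
  ℓ₀ : V n → Bool
  ℓ₀ u = ℓ (false ∷ u)

  ℓ-∷ : ∀ s u → ℓ (s ∷ u) ≡ s xor ℓ₀ u
  ℓ-∷ s u = trans (linearForm-∷ ℓ lin s u) (trans (cong (λ x → (s ∧ x) xor ℓ₀ u) ℓe₀) (cong (_xor ℓ₀ u) (∧-identityʳ s)))

  graph : V n → V (suc n)
  graph u = ℓ₀ u ∷ u

  graph-linear : IsLinear graph
  graph-linear u u′ = cong (_∷ (u ⊕ u′)) (lin (false ∷ u) (false ∷ u′))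

kernel-tail {zero} ℓ lin ℓe₀ (s ∷ []) ℓv≡true = ⊥-elim (true≢false (begin
  true                             ≡⟨ ℓv≡true ⟨
  ℓ (s ∷ [])                       ≡⟨ linearForm-∷ ℓ lin s [] ⟩
  (s ∧ ℓ e₀) xor ℓ (false ∷ [])    ≡⟨ cong₂ (λ x y → (s ∧ x) xor y) ℓe₀ (linearForm-𝟘 ℓ lin) ⟩
  (s ∧ false) xor false            ≡⟨ cong (_xor false) (∧-zeroʳ s) ⟩
  false                            ∎))
  where open ≡-Reasoning
kernel-tail {suc n} ℓ lin ℓe₀ (s₀ ∷ u₀) ℓv≡true = record
  { embedding   = record { fun = shift ; linear = shift-linear ; inj = shift-injective }
  ; annihilated = λ { (s ∷ w) → trans (ℓ-∷ s (fun κ w)) (annihilated K w) }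
  ; exhaustive  = λ { (s ∷ u) ℓz≡false → let (w , κw≡u) = exhaustive K u (trans (sym (ℓ-∷ s u)) ℓz≡false)
                                         in s ∷ w , cong (s ∷_) κw≡u }
  }
  where
  ℓ₀ : V (suc n) → Bool
  ℓ₀ u = ℓ (false ∷ u)

  ℓ-∷ : ∀ s u → ℓ (s ∷ u) ≡ ℓ₀ u
  ℓ-∷ s u = trans (linearForm-∷ ℓ lin s u) (trans (cong (λ x → (s ∧ x) xor ℓ₀ u) ℓe₀) (cong (_xor ℓ₀ u) (∧-zeroʳ s)))

  K : Kernel ℓ₀
  K = kernel ℓ₀ (λ u u′ → lin (false ∷ u) (false ∷ u′)) u₀ (trans (sym (ℓ-∷ s₀ u₀)) ℓv≡true)

  κ = embedding K

  shift : V (suc n) → V (suc (suc n))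
  shift (s ∷ w) = s ∷ fun κ w

  shift-linear : IsLinear shift
  shift-linear (s ∷ w) (s′ ∷ w′) = cong ((s xor s′) ∷_) (linear κ w w′)

  shift-injective : IsInjective shift
  shift-injective (s ∷ w) (s′ ∷ w′) eq = cong₂ _∷_ (∷-injectiveˡ eq) (inj κ w w′ (∷-injectiveʳ eq))

-- Quadratic functions

polar : ∀ {n} → (V n → Bool) → V n → V n → Bool
polar f a b = f (a ⊕ b) xor f a xor f b

record IsQuadratic {n} (f : V n → Bool) : Set where
  field
    vanishes-𝟘    : f (𝟘 n) ≡ false
    polar-linearˡ : ∀ b → IsLinearForm (λ a → polar f a b)

polar-comm : ∀ {n} (f : V n → Bool) a b → polar f a b ≡ polar f b a
polar-comm f a b = cong₂ _xor_ (cong f (⊕-comm a b)) (xor-comm (f a) (f b))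

f-⊕ : ∀ {n} (f : V n → Bool) a b → f (a ⊕ b) ≡ f a xor f b xor polar f a b
f-⊕ f a b = lemma (f (a ⊕ b)) (f a) (f b)
  where
  lemma : ∀ F p q → F ≡ p xor q xor F xor p xor q
  lemma true  true  true  = refl
  lemma true  true  false = refl
  lemma true  false true  = refl
  lemma true  false false = refl
  lemma false true  true  = refl
  lemma false true  false = refl
  lemma false false true  = refl
  lemma false false false = refl

polar-𝟘ˡ : ∀ {n} (f : V n → Bool) → f (𝟘 n) ≡ false → ∀ b → polar f (𝟘 n) b ≡ false
polar-𝟘ˡ f f𝟘 b = begin
  f (𝟘 _ ⊕ b) xor f (𝟘 _) xor f b  ≡⟨ cong₂ (λ x y → x xor y xor f b) (cong f (⊕-identityˡ b)) f𝟘 ⟩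
  f b xor f b                      ≡⟨ xor-same (f b) ⟩
  false                            ∎
  where open ≡-Reasoning

polar-𝟘ʳ : ∀ {n} (f : V n → Bool) → f (𝟘 n) ≡ false → ∀ a → polar f a (𝟘 n) ≡ false
polar-𝟘ʳ f f𝟘 a = trans (polar-comm f a _) (polar-𝟘ˡ f f𝟘 a)

polar-self : ∀ {n} (f : V n → Bool) → f (𝟘 n) ≡ false → ∀ a → polar f a a ≡ false
polar-self f f𝟘 a = cong₂ _xor_ (trans (cong f (⊕-same a)) f𝟘) (xor-same (f a))

polar-⊕-cancel : ∀ {n} (f : V n → Bool) a b → polar f (a ⊕ b) b ≡ polar f a b
polar-⊕-cancel f a b = begin
  f ((a ⊕ b) ⊕ b) xor f (a ⊕ b) xor f b  ≡⟨ cong (λ x → f x xor f (a ⊕ b) xor f b) (⊕-cancelʳ a b) ⟩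
  f a xor f (a ⊕ b) xor f b              ≡⟨ xor-assoc (f a) _ _ ⟨
  (f a xor f (a ⊕ b)) xor f b            ≡⟨ cong (_xor f b) (xor-comm (f a) _) ⟩
  (f (a ⊕ b) xor f a) xor f b            ≡⟨ xor-assoc (f (a ⊕ b)) _ _ ⟩
  f (a ⊕ b) xor f a xor f b              ∎
  where open ≡-Reasoning

polar-∘ : ∀ {m n} (f : V n → Bool) {φ : V m → V n} → IsLinear φ → ∀ a b →
          polar (λ u → f (φ u)) a b ≡ polar f (φ a) (φ b)
polar-∘ f {φ} lin a b = cong (λ x → f x xor f (φ a) xor f (φ b)) (lin a b)

polar≡false⇒linearForm : ∀ {n} (f : V n → Bool) → (∀ a b → polar f a b ≡ false) → IsLinearForm f
polar≡false⇒linearForm f polar≡false a b =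
  trans (f-⊕ f a b) (trans (cong (λ x → f a xor f b xor x) (polar≡false a b)) (cong (f a xor_) (xor-identityʳ (f b))))

IsQuadratic-∘ : ∀ {m n} {f : V n → Bool} → IsQuadratic f → {φ : V m → V n} → IsLinear φ → IsQuadratic (λ u → f (φ u))
IsQuadratic-∘ {f = f} q {φ} lin = record
  { vanishes-𝟘    = trans (cong f (linear-𝟘 φ lin)) (IsQuadratic.vanishes-𝟘 q)
  ; polar-linearˡ = λ b u v → begin
      polar (λ u → f (φ u)) (u ⊕ v) b            ≡⟨ polar-∘ f lin (u ⊕ v) b ⟩
      polar f (φ (u ⊕ v)) (φ b)                   ≡⟨ cong (λ x → polar f x (φ b)) (lin u v) ⟩
      polar f (φ u ⊕ φ v) (φ b)                   ≡⟨ IsQuadratic.polar-linearˡ q (φ b) (φ u) (φ v) ⟩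
      polar f (φ u) (φ b) xor polar f (φ v) (φ b) ≡⟨ sym (cong₂ _xor_ (polar-∘ f lin u b) (polar-∘ f lin v b)) ⟩
      polar (λ u → f (φ u)) u b xor polar (λ u → f (φ u)) v b ∎
  }
  where open ≡-Reasoning

module Quadratic {n} {f : V n → Bool} (q : IsQuadratic f) where
  open IsQuadratic q public

  polar-linearʳ : ∀ a → IsLinearForm (polar f a)
  polar-linearʳ a u v = begin
    polar f a (u ⊕ v)                 ≡⟨ polar-comm f a (u ⊕ v) ⟩
    polar f (u ⊕ v) a                 ≡⟨ polar-linearˡ a u v ⟩
    polar f u a xor polar f v a       ≡⟨ cong₂ _xor_ (polar-comm f u a) (polar-comm f v a) ⟩
    polar f a u xor polar f a v       ∎
    where open ≡-Reasoning

  f-·⊕ : ∀ s a b → f (s · a ⊕ b) ≡ (s ∧ f a) xor f b xor (s ∧ polar f a b)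
  f-·⊕ true  a b = f-⊕ f a b
  f-·⊕ false a b = trans (cong f (⊕-identityˡ b)) (sym (xor-identityʳ (f b)))

-- Matroids in 𝓔₃ are quadratic

bit : Bool → ℕ
bit b = if b then 1 else 0

xorSum : List Bool → Bool
xorSum = foldr _xor_ false

parity-bit-xor : ∀ a b → parity (bit (a xor b)) ≡ parity (bit a) +ℙ parity (bit b)
parity-bit-xor true  true  = refl
parity-bit-xor true  false = refl
parity-bit-xor false b     = refl

parity-count : ∀ {A : Set} (g : A → Bool) xs →
               parity (sum (List.map (λ x → bit (g x)) xs)) ≡ parity (bit (xorSum (List.map g xs)))
parity-count g []ₗ       = refl
parity-count g (x ∷ₗ xs) = begin
  parity (bit (g x) + sum (List.map (λ x → bit (g x)) xs))   ≡⟨ +-homo-+ (bit (g x)) _ ⟩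
  parity (bit (g x)) +ℙ parity (sum (List.map (λ x → bit (g x)) xs)) ≡⟨ cong (parity (bit (g x)) +ℙ_) (parity-count g xs) ⟩
  parity (bit (g x)) +ℙ parity (bit (xorSum (List.map g xs))) ≡⟨ parity-bit-xor (g x) _ ⟨
  parity (bit (g x xor xorSum (List.map g xs)))               ∎
  where open ≡-Reasoning

even-count⇒xorSum≡false : ∀ {A : Set} (g : A → Bool) xs →
                          2 ∣ sum (List.map (λ x → bit (g x)) xs) → xorSum (List.map g xs) ≡ false
even-count⇒xorSum≡false g xs (divides k eq) = bit-parity (trans (sym (parity-count g xs)) even)
  where
  even : parity (sum (List.map (λ x → bit (g x)) xs)) ≡ 0ℙ
  even = trans (cong parity eq) (trans (*-homo-* k 2) (*-zeroʳ (parity k)))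
  bit-parity : ∀ {b} → parity (bit b) ≡ 0ℙ → b ≡ false
  bit-parity {false} _ = refl

-- frame a b c (s ∷ t ∷ u ∷ []) = s · a ⊕ (t · b ⊕ u · c), tabulated so that the count of a 3-flat
-- unfolds definitionally to the seven values of f on it.
frame : ∀ {n} → V n → V n → V n → V 3 → V n
frame a b c (false ∷ false ∷ false ∷ []) = 𝟘 _
frame a b c (false ∷ false ∷ true  ∷ []) = c
frame a b c (false ∷ true  ∷ false ∷ []) = b
frame a b c (false ∷ true  ∷ true  ∷ []) = b ⊕ c
frame a b c (true  ∷ false ∷ false ∷ []) = a
frame a b c (true  ∷ false ∷ true  ∷ []) = a ⊕ c
frame a b c (true  ∷ true  ∷ false ∷ []) = a ⊕ b
frame a b c (true  ∷ true  ∷ true  ∷ []) = a ⊕ (b ⊕ c)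

frame-combination : ∀ {n} (a b c : V n) s t u → frame a b c (s ∷ t ∷ u ∷ []) ≡ s · a ⊕ (t · b ⊕ u · c)
frame-combination a b c false false false = sym (trans (⊕-identityˡ _) (⊕-same _))
frame-combination a b c false false true  = sym (trans (⊕-identityˡ _) (⊕-identityˡ c))
frame-combination a b c false true  false = sym (trans (⊕-identityˡ _) (⊕-identityʳ b))
frame-combination a b c false true  true  = sym (⊕-identityˡ _)
frame-combination a b c true  false false = sym (trans (cong (a ⊕_) (⊕-same _)) (⊕-identityʳ a))
frame-combination a b c true  false true  = sym (cong (a ⊕_) (⊕-identityˡ c))
frame-combination a b c true  true  false = sym (cong (a ⊕_) (⊕-identityʳ b))
frame-combination a b c true  true  true  = refl

frame-linear : ∀ {n} (a b c : V n) → IsLinear (frame a b c)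
frame-linear a b c (s ∷ t ∷ u ∷ []) (s′ ∷ t′ ∷ u′ ∷ []) = begin
  frame a b c ((s xor s′) ∷ (t xor t′) ∷ (u xor u′) ∷ [])
    ≡⟨ frame-combination a b c (s xor s′) (t xor t′) (u xor u′) ⟩
  (s xor s′) · a ⊕ ((t xor t′) · b ⊕ (u xor u′) · c)
    ≡⟨ cong₂ _⊕_ (·-distribʳ-xor s s′ a) (cong₂ _⊕_ (·-distribʳ-xor t t′ b) (·-distribʳ-xor u u′ c)) ⟩
  (s · a ⊕ s′ · a) ⊕ ((t · b ⊕ t′ · b) ⊕ (u · c ⊕ u′ · c))
    ≡⟨ cong ((s · a ⊕ s′ · a) ⊕_) (⊕-interchange (t · b) _ _ _) ⟩
  (s · a ⊕ s′ · a) ⊕ ((t · b ⊕ u · c) ⊕ (t′ · b ⊕ u′ · c))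
    ≡⟨ ⊕-interchange (s · a) _ _ _ ⟩
  (s · a ⊕ (t · b ⊕ u · c)) ⊕ (s′ · a ⊕ (t′ · b ⊕ u′ · c))
    ≡⟨ sym (cong₂ _⊕_ (frame-combination a b c s t u) (frame-combination a b c s′ t′ u′)) ⟩
  frame a b c (s ∷ t ∷ u ∷ []) ⊕ frame a b c (s′ ∷ t′ ∷ u′ ∷ []) ∎
  where open ≡-Reasoning

polarDefect : ∀ {n} → (V n → Bool) → V n → V n → V n → Bool
polarDefect f a b c = polar f (a ⊕ b) c xor polar f a c xor polar f b c

module _ {n} (f : V n → Bool) (f𝟘 : f (𝟘 n) ≡ false) where

  private
    defect-from : ∀ {a b c x y z} → polar f (a ⊕ b) c ≡ x → polar f a c ≡ y → polar f b c ≡ z →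
          x xor y xor z ≡ false → polarDefect f a b c ≡ false
    defect-from p q r s = trans (cong₂ _xor_ p (cong₂ _xor_ q r)) s

    ⊥𝟘 : ∀ a → polar f a (𝟘 n) ≡ false
    ⊥𝟘 = polar-𝟘ʳ f f𝟘

    𝟘⊥ : ∀ c → polar f (𝟘 n) c ≡ false
    𝟘⊥ = polar-𝟘ˡ f f𝟘

    self-cancel : ∀ p → p xor p xor false ≡ false
    self-cancel p = trans (cong (p xor_) (xor-identityʳ p)) (xor-same p)

  polarDefect-degenerate : ∀ a b c v → v ≢ 𝟘 3 → frame a b c v ≡ 𝟘 n → polarDefect f a b c ≡ false
  polarDefect-degenerate a b c (false ∷ false ∷ false ∷ []) v≢𝟘 _ = ⊥-elim (v≢𝟘 refl)
  polarDefect-degenerate a b c (false ∷ false ∷ true ∷ []) _ refl = defect-from (⊥𝟘 (a ⊕ b)) (⊥𝟘 a) (⊥𝟘 b) refl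
  polarDefect-degenerate a b c (false ∷ true ∷ false ∷ []) _ refl =
    defect-from (cong (λ x → polar f x c) (⊕-identityʳ a)) refl (𝟘⊥ c) (self-cancel (polar f a c))
  polarDefect-degenerate a b c (false ∷ true ∷ true ∷ []) _ b⊕c≡𝟘 with ⊕≡𝟘⇒≡ b⊕c≡𝟘
  ... | refl = defect-from (polar-⊕-cancel f a b) refl (polar-self f f𝟘 b) (self-cancel (polar f a b))
  polarDefect-degenerate a b c (true ∷ false ∷ false ∷ []) _ refl =
    defect-from (cong (λ x → polar f x c) (⊕-identityˡ b)) (𝟘⊥ c) refl (xor-same (polar f b c))
  polarDefect-degenerate a b c (true ∷ false ∷ true ∷ []) _ a⊕c≡𝟘 with ⊕≡𝟘⇒≡ a⊕c≡𝟘
  ... | refl = defect-from (trans (cong (λ x → polar f x a) (⊕-comm a b)) (polar-⊕-cancel f b a)) (polar-self f f𝟘 a) refl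
                   (xor-same (polar f b a))
  polarDefect-degenerate a b c (true ∷ true ∷ false ∷ []) _ a⊕b≡𝟘 with ⊕≡𝟘⇒≡ a⊕b≡𝟘
  ... | refl = defect-from (trans (cong (λ x → polar f x c) (⊕-same a)) (𝟘⊥ c)) refl refl (xor-same (polar f a c))
  polarDefect-degenerate a b c (true ∷ true ∷ true ∷ []) _ a⊕b⊕c≡𝟘 with ⊕≡𝟘⇒≡ a⊕b⊕c≡𝟘
  ... | refl = defect-from (trans (cong (λ x → polar f x c) (trans (cong (_⊕ b) (⊕-comm b c)) (⊕-cancelʳ c b))) (polar-self f f𝟘 c))
                   (polar-⊕-cancel f b c) refl (xor-same (polar f b c))

polarDefect-cube : ∀ {n} (f : V n → Bool) a b c →
                   polarDefect f a b c ≡ xorSum (List.map (λ x → isNZ x ∧ f (frame a b c x)) (allVecs 3))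
polarDefect-cube f a b c =
  trans (cong (λ x → (f x xor f (a ⊕ b) xor f c) xor polar f a c xor polar f b c) (⊕-assoc a b c))
        (identity (f a) (f b) (f c) (f (a ⊕ b)) (f (a ⊕ c)) (f (b ⊕ c)) (f (a ⊕ (b ⊕ c))))
  where
  open Algebra.Solver.CommutativeMonoid (CommutativeRing.+-commutativeMonoid xor-∧-commutativeRing) using (prove; var) renaming (_⊕_ to _⊞_; id to ε)
  identity : ∀ p q r s t u w →
             (w xor s xor r) xor (t xor p xor r) xor (u xor q xor r) ≡ r xor q xor u xor p xor t xor s xor w xor false
  identity p q r s t u w = begin
    (w xor s xor r) xor (t xor p xor r) xor (u xor q xor r)
      ≡⟨ prove 7 ((W ⊞ (S ⊞ R)) ⊞ ((T ⊞ (P ⊞ R)) ⊞ (U ⊞ (Q ⊞ R))))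
                 ((R ⊞ (R ⊞ R)) ⊞ (Q ⊞ (U ⊞ (P ⊞ (T ⊞ (S ⊞ (W ⊞ ε)))))))
                 (p ∷ q ∷ r ∷ s ∷ t ∷ u ∷ w ∷ []) ⟩
    (r xor r xor r) xor (q xor u xor p xor t xor s xor w xor false)
      ≡⟨ cong (λ x → (r xor x) xor _) (xor-same r) ⟩
    (r xor false) xor (q xor u xor p xor t xor s xor w xor false)
      ≡⟨ cong (_xor _) (xor-identityʳ r) ⟩
    r xor q xor u xor p xor t xor s xor w xor false ∎
    where
    open ≡-Reasoning
    P = var zero
    Q = var (suc zero)
    R = var (suc (suc zero))
    S = var (suc (suc (suc zero)))
    T = var (suc (suc (suc (suc zero))))
    U = var (suc (suc (suc (suc (suc zero)))))
    W = var (suc (suc (suc (suc (suc (suc zero))))))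

E3⇒quadratic : ∀ M → InE3 M → IsQuadratic (E M)
E3⇒quadratic M e3 = record
  { vanishes-𝟘    = E-0 M
  ; polar-linearˡ = λ c a b → xor≡false⇒≡ (polarDefect≡false a b c)
  }
  where
  polarDefect≡false : ∀ a b c → polarDefect (E M) a b c ≡ false
  polarDefect≡false a b c with ∀-or-∃ (λ v → kernel-test v)
    where
    kernel-test : ∀ v → (frame a b c v ≡ 𝟘 (dim M) → v ≡ 𝟘 3) ⊎ (v ≢ 𝟘 3 × frame a b c v ≡ 𝟘 (dim M))
    kernel-test v with v ≟ 𝟘 3 | frame a b c v ≟ 𝟘 (dim M)
    ... | yes v≡𝟘 | _         = inj₁ λ _ → v≡𝟘
    ... | no v≢𝟘  | yes fv≡𝟘  = inj₂ (v≢𝟘 , fv≡𝟘)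
    ... | no _    | no fv≢𝟘   = inj₁ λ fv≡𝟘 → ⊥-elim (fv≢𝟘 fv≡𝟘)
  ... | inj₂ (v , v≢𝟘 , fv≡𝟘) = polarDefect-degenerate (E M) (E-0 M) a b c v v≢𝟘 fv≡𝟘
  ... | inj₁ kernel-trivial =
    trans (polarDefect-cube (E M) a b c)
          (even-count⇒xorSum≡false (λ x → isNZ x ∧ E M (frame a b c x)) (allVecs 3)
                                   (e3 3 (s≤s (s≤s (s≤s z≤n))) φ))
    where
    φ : Embedding 3 (dim M)
    φ = record { fun = frame a b c ; linear = frame-linear a b c
               ; inj = trivialKernel⇒injective (frame a b c) (frame-linear a b c) kernel-trivial }

-- Hyperbolic families

Pair : ℕ → Set
Pair n = V n × V n

Orthogonal : ∀ {n} → (V n → Bool) → V n → ∀ {R} → Vec (Pair n) R → Set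
Orthogonal f z = All λ { (a , b) → polar f z a ≡ false × polar f z b ≡ false }

data Hyperbolic {n} (f : V n → Bool) : ∀ {R} → Vec (Pair n) R → Set where
  []   : Hyperbolic f []
  cons : ∀ {R x y} {ps : Vec (Pair n) R} → polar f x y ≡ true →
         Orthogonal f x ps → Orthogonal f y ps → Hyperbolic f ps → Hyperbolic f ((x , y) ∷ ps)

mapPairs : ∀ {m n R} → (V m → V n) → Vec (Pair m) R → Vec (Pair n) R
mapPairs φ = map λ { (a , b) → φ a , φ b }

module _ {m n} (f : V n → Bool) (ψ : Embedding m n) where

  private
    polar-ψ : ∀ a b → polar (λ u → f (fun ψ u)) a b ≡ polar f (fun ψ a) (fun ψ b)
    polar-ψ = polar-∘ f (linear ψ)

  Orthogonal-image : ∀ {z R} (ps : Vec (Pair m) R) → (∀ w → polar f z (fun ψ w) ≡ false) → Orthogonal f z (mapPairs (fun ψ) ps)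
  Orthogonal-image ps z⊥ψ = map⁺ (All.universal (λ { (a , b) → z⊥ψ a , z⊥ψ b }) ps)

  Orthogonal-map : ∀ {z R} {ps : Vec (Pair m) R} → Orthogonal (λ u → f (fun ψ u)) z ps → Orthogonal f (fun ψ z) (mapPairs (fun ψ) ps)
  Orthogonal-map {z} z⊥ = map⁺ (All.map (λ { {a , b} (za , zb) → trans (sym (polar-ψ z a)) za , trans (sym (polar-ψ z b)) zb }) z⊥)

  Hyperbolic-map : ∀ {R} {ps : Vec (Pair m) R} → Hyperbolic (λ u → f (fun ψ u)) ps → Hyperbolic f (mapPairs (fun ψ) ps)
  Hyperbolic-map []                  = []
  Hyperbolic-map (cons {x = x} {y} xy x⊥ y⊥ h) = cons (trans (sym (polar-ψ x y)) xy) (Orthogonal-map x⊥) (Orthogonal-map y⊥) (Hyperbolic-map h)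

VanishingFlat : ∀ {n} → (V n → Bool) → ℕ → Set
VanishingFlat {n} f k = Σ ℕ λ d → d + k ≡ n × Σ (Embedding d n) λ φ → ∀ x → f (fun φ x) ≡ false

VanishingFlat-∘ : ∀ {m n c k} {f : V n → Bool} (ψ : Embedding m n) → c + m ≡ n →
                  VanishingFlat (λ u → f (fun ψ u)) k → VanishingFlat f (c + k)
VanishingFlat-∘ {c = c} {k} ψ c+m≡n (d , d+k≡m , φ , f∘φ≡false) =
  d , d+[c+k]≡n , ψ ∘ₑ φ , f∘φ≡false
  where
  open ≡-Reasoning
  d+[c+k]≡n : d + (c + k) ≡ _
  d+[c+k]≡n = begin
    d + (c + k)  ≡⟨ +-assoc d c k ⟨
    (d + c) + k  ≡⟨ cong (_+ k) (+-comm d c) ⟩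
    (c + d) + k  ≡⟨ +-assoc c d k ⟩
    c + (d + k)  ≡⟨ cong (c +_) d+k≡m ⟩
    c + _        ≡⟨ c+m≡n ⟩
    _            ∎

linearForm-vanishingFlat : ∀ {n} (ℓ : V n → Bool) → IsLinearForm ℓ → ∃ λ k → k ≤ 1 × VanishingFlat ℓ k
linearForm-vanishingFlat {n} ℓ lin with ∀-or-∃ (λ v → false-or-true (ℓ v))
... | inj₁ ℓ≡false = 0 , z≤n , n , +-identityʳ n , idₑ , ℓ≡false
linearForm-vanishingFlat {zero} ℓ lin | inj₂ ([] , ℓ𝟘≡true) = ⊥-elim (true≢false (trans (sym ℓ𝟘≡true) (linearForm-𝟘 ℓ lin)))
linearForm-vanishingFlat {suc n} ℓ lin | inj₂ (v , ℓv≡true) =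
  1 , s≤s z≤n , n , +-comm n 1 , Kernel.embedding K , Kernel.annihilated K
  where K = kernel ℓ lin v ℓv≡true

pairComplement : ∀ {n} {f : V n → Bool} → IsQuadratic f → ∀ x y → polar f x y ≡ true →
                 Σ ℕ λ m → 2 + m ≡ n × Σ (Embedding m n) λ ψ →
                   ∀ w → polar f x (fun ψ w) ≡ false × polar f y (fun ψ w) ≡ false
pairComplement {zero} {f} q [] [] xy = ⊥-elim (true≢false (trans (sym xy) (polar-self f (IsQuadratic.vanishes-𝟘 q) [])))
pairComplement {suc zero} {f} q x y xy = ⊥-elim (true≢false (trans (sym xy) (trans (cong (λ z → polar f z y) x≡𝟘) (polar-𝟘ˡ f vanishes-𝟘 y))))
  where
  open Quadratic q
  K₁ = kernel (polar f x) (polar-linearʳ x) y xy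
  x≡𝟘 : x ≡ 𝟘 1
  x≡𝟘 with Kernel.exhaustive K₁ x (polar-self f vanishes-𝟘 x)
  ... | [] , κ₁𝟘≡x = trans (sym κ₁𝟘≡x) (linear-𝟘 _ (linear (Kernel.embedding K₁)))
pairComplement {suc (suc m)} {f} q x y xy = m , refl , κ₁ ∘ₑ Kernel.embedding K₂ ,
  λ w → Kernel.annihilated K₁ _ , Kernel.annihilated K₂ w
  where
  open Quadratic q
  K₁ = kernel (polar f x) (polar-linearʳ x) y xy
  κ₁ = Kernel.embedding K₁
  ℓ₂ : V (suc m) → Bool
  ℓ₂ u = polar f y (fun κ₁ u)
  x∈K₁ = Kernel.exhaustive K₁ x (polar-self f vanishes-𝟘 x)
  K₂ = kernel ℓ₂ (λ u u′ → trans (cong (polar f y) (linear κ₁ u u′)) (polar-linearʳ y _ _)) (proj₁ x∈K₁)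
              (trans (cong (polar f y) (proj₂ x∈K₁)) (trans (polar-comm f y x) xy))

HyperbolicFamily : ∀ {n} → (V n → Bool) → ℕ → Set
HyperbolicFamily {n} f R = Σ (Vec (Pair n) R) (Hyperbolic f)

dichotomy : ∀ R {n} {f : V n → Bool} → IsQuadratic f →
            HyperbolicFamily f R ⊎ ∃ λ k → k ≤ suc (R * 2) × VanishingFlat f k
dichotomy zero    q = inj₁ ([] , [])
dichotomy (suc R) {f = f} q
  with ∀-or-∃ (λ x → ∀-or-∃ (λ y → false-or-true (polar f x y)))
... | inj₁ polar≡false with linearForm-vanishingFlat f (polar≡false⇒linearForm f polar≡false)
...   | k , k≤1 , flat = inj₂ (k , ≤-trans k≤1 (s≤s z≤n) , flat)
dichotomy (suc R) {f = f} q | inj₂ (x , y , xy) with pairComplement q x y xy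
... | m , 2+m≡n , ψ , ψ⊥ with dichotomy R (IsQuadratic-∘ q (linear ψ))
...   | inj₁ (ps , h) =
  inj₁ ((x , y) ∷ mapPairs (fun ψ) ps ,
        cons xy (Orthogonal-image f ψ ps (λ w → proj₁ (ψ⊥ w))) (Orthogonal-image f ψ ps (λ w → proj₂ (ψ⊥ w)))
                (Hyperbolic-map f ψ h))
...   | inj₂ (k , k≤ , flat) = inj₂ (2 + k , s≤s (s≤s k≤) , VanishingFlat-∘ {f = f} ψ 2+m≡n flat)

-- Realizing quadratic functions

-- b ∈ ps^⊥⊥; for a hyperbolic family this plays the role of "b lies in the span of ps".
InSpan : ∀ {n} → (V n → Bool) → ∀ {R} → Vec (Pair n) R → V n → Set
InSpan f ps b = ∀ z → Orthogonal f z ps → polar f z b ≡ false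

record Realization {m n} (f : V n → Bool) {R} (ps : Vec (Pair n) R) (g : V m → Bool) : Set where
  field
    embedding : Embedding m n
    restricts : ∀ u → f (fun embedding u) ≡ g u
    inSpan    : ∀ u → InSpan f ps (fun embedding u)
    -- lets the next generator be chosen with prescribed polar pairings against the image
    dual      : ∀ μ → IsLinearForm μ → ∃ λ b → InSpan f ps b × ∀ u → polar f b (fun embedding u) ≡ μ u
open Realization

module _ {n} {f : V n → Bool} (q : IsQuadratic f) where
  open Quadratic q

  private
    polar-·ˡ : ∀ s a b → polar f (s · a) b ≡ s ∧ polar f a b
    polar-·ˡ s a b = linearForm-· (λ a → polar f a b) (polar-linearˡ b) s a

    ∧false : ∀ s {x} → x ≡ false → s ∧ x ≡ false
    ∧false s refl = ∧-zeroʳ s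

  oddVector : ∀ {x y} → polar f x y ≡ true →
              ∃ λ w → f w ≡ true × InSpan f ((x , y) ∷ []) w
  oddVector {x} {y} xy with false-or-true (f x) | false-or-true (f y)
  ... | inj₂ fx≡true  | _             = x , fx≡true , λ { z ((zx , _) ∷ []) → zx }
  ... | inj₁ _        | inj₂ fy≡true  = y , fy≡true , λ { z ((_ , zy) ∷ []) → zy }
  ... | inj₁ fx≡false | inj₁ fy≡false =
    x ⊕ y , f[x⊕y]≡true , λ { z ((zx , zy) ∷ []) → trans (polar-linearʳ z x y) (cong₂ _xor_ zx zy) }
    where
    f[x⊕y]≡true : f (x ⊕ y) ≡ true
    f[x⊕y]≡true = trans (f-⊕ f x y) (trans (cong₂ (λ a b → a xor b xor polar f x y) fx≡false fy≡false) xy)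

  Orthogonal-⊕ : ∀ {z z′ R} {ps : Vec (Pair n) R} → Orthogonal f z ps → Orthogonal f z′ ps → Orthogonal f (z ⊕ z′) ps
  Orthogonal-⊕ [] [] = []
  Orthogonal-⊕ {z} {z′} ((za , zb) ∷ z⊥) ((z′a , z′b) ∷ z′⊥) =
    (trans (polar-linearˡ _ z z′) (cong₂ _xor_ za z′a) , trans (polar-linearˡ _ z z′) (cong₂ _xor_ zb z′b))
    ∷ Orthogonal-⊕ z⊥ z′⊥

  Orthogonal-· : ∀ s {z R} {ps : Vec (Pair n) R} → Orthogonal f z ps → Orthogonal f (s · z) ps
  Orthogonal-· s {z} = All.map λ { {a , b} (za , zb) → trans (polar-·ˡ s z a) (∧false s za) , trans (polar-·ˡ s z b) (∧false s zb) }

  Orthogonal-span : ∀ {x y w R} {ps : Vec (Pair n) R} → Orthogonal f x ps → Orthogonal f y ps →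
                    InSpan f ((x , y) ∷ []) w → Orthogonal f w ps
  Orthogonal-span [] [] _ = []
  Orthogonal-span ((xa , xb) ∷ x⊥) ((ya , yb) ∷ y⊥) w∈ =
    (⊥-sym (w∈ _ ((⊥-sym xa , ⊥-sym ya) ∷ [])) , ⊥-sym (w∈ _ ((⊥-sym xb , ⊥-sym yb) ∷ []))) ∷ Orthogonal-span x⊥ y⊥ w∈
    where
    ⊥-sym : ∀ {a b} → polar f a b ≡ false → polar f b a ≡ false
    ⊥-sym {a} {b} = trans (polar-comm f b a)

  -- x₁ pairs to true with y₁; adding a multiple of a vector w from the second pair with f w ≡ true sets the value of f
  -- without changing any pairing with y₁ or with ps.
  prescribedValue : ∀ {R x₁ y₁ x₂ y₂} {ps : Vec (Pair n) R} → Hyperbolic f ((x₁ , y₁) ∷ (x₂ , y₂) ∷ ps) → ∀ τ →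
                    ∃ λ a → f a ≡ τ × polar f y₁ a ≡ true × Orthogonal f a ps × InSpan f ((x₁ , y₁) ∷ (x₂ , y₂) ∷ ps) a
  prescribedValue {x₁ = x₁} {y₁} (cons x₁y₁ ((x₁x₂ , x₁y₂) ∷ x₁⊥) ((y₁x₂ , y₁y₂) ∷ _) (cons x₂y₂ x₂⊥ y₂⊥ _)) τ
    with oddVector x₂y₂
  ... | w , fw≡true , w∈ = a , fa≡τ , y₁a≡true , Orthogonal-⊕ (Orthogonal-· t (Orthogonal-span x₂⊥ y₂⊥ w∈)) x₁⊥ , a∈
    where
    t = τ xor f x₁
    a = t · w ⊕ x₁

    polar-a : ∀ z → polar f z a ≡ (t ∧ polar f z w) xor polar f z x₁
    polar-a z = linearForm-·⊕ (polar f z) (polar-linearʳ z) t w x₁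

    fa≡τ : f a ≡ τ
    fa≡τ = begin
      f (t · w ⊕ x₁)                                        ≡⟨ f-·⊕ t w x₁ ⟩
      (t ∧ f w) xor f x₁ xor (t ∧ polar f w x₁)             ≡⟨ cong₂ (λ p r → (t ∧ p) xor f x₁ xor (t ∧ r)) fw≡true
                                                                       (trans (polar-comm f w x₁) (w∈ x₁ ((x₁x₂ , x₁y₂) ∷ []))) ⟩
      ((τ xor f x₁) ∧ true) xor f x₁ xor ((τ xor f x₁) ∧ false) ≡⟨ cancel τ (f x₁) ⟩
      τ                                                     ∎
      where
      open ≡-Reasoning
      cancel : ∀ τ p → ((τ xor p) ∧ true) xor p xor ((τ xor p) ∧ false) ≡ τ
      cancel true  true  = refl
      cancel true  false = refl
      cancel false true  = refl
      cancel false false = refl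

    y₁a≡true : polar f y₁ a ≡ true
    y₁a≡true = trans (polar-a y₁) (cong₂ _xor_ (∧false t (w∈ y₁ ((y₁x₂ , y₁y₂) ∷ []))) (trans (polar-comm f y₁ x₁) x₁y₁))

    a∈ : InSpan f _ a
    a∈ z ((zx₁ , _) ∷ (zx₂ , zy₂) ∷ _) = trans (polar-a z) (cong₂ _xor_ (∧false t (w∈ z ((zx₂ , zy₂) ∷ []))) zx₁)

  nextGenerator : ∀ {m R x₁ y₁ x₂ y₂} {ps : Vec (Pair n) R} {g : V m → Bool} →
              Hyperbolic f ((x₁ , y₁) ∷ (x₂ , y₂) ∷ ps) → (r : Realization f ps g) →
              ∀ τ ℓ → IsLinearForm ℓ →
              ∃ λ v → f v ≡ τ × (∀ u → polar f v (fun (embedding r) u) ≡ ℓ u) ×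
                      polar f y₁ v ≡ true × InSpan f ((x₁ , y₁) ∷ (x₂ , y₂) ∷ ps) v
  nextGenerator {y₁ = y₁} h@(cons _ _ (_ ∷ y₁⊥) _) r τ ℓ ℓ-linear with dual r ℓ ℓ-linear
  ... | b , b∈ps , bpolar with prescribedValue h (τ xor f b)
  ...   | a , fa , y₁a , a⊥ps , a∈ = a ⊕ b , f[a⊕b]≡τ , polar-φ , y₁[a⊕b]≡true , a⊕b∈
    where

    f[a⊕b]≡τ : f (a ⊕ b) ≡ τ
    f[a⊕b]≡τ = trans (f-⊕ f a b) (trans (cong₂ (λ x y → x xor f b xor y) fa (b∈ps a a⊥ps)) (cancel τ (f b)))
      where
      cancel : ∀ τ p → (τ xor p) xor p xor false ≡ τ
      cancel true  true  = refl
      cancel true  false = refl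
      cancel false true  = refl
      cancel false false = refl

    polar-φ : ∀ u → polar f (a ⊕ b) (fun (embedding r) u) ≡ ℓ u
    polar-φ u = trans (polar-linearˡ _ a b) (cong₂ _xor_ (inSpan r u a a⊥ps) (bpolar u))

    y₁[a⊕b]≡true : polar f y₁ (a ⊕ b) ≡ true
    y₁[a⊕b]≡true = trans (polar-linearʳ y₁ a b) (cong₂ _xor_ y₁a (b∈ps y₁ y₁⊥))

    a⊕b∈ : InSpan f _ (a ⊕ b)
    a⊕b∈ z z⊥@(_ ∷ _ ∷ z⊥ps) = trans (polar-linearʳ z a b) (cong₂ _xor_ (a∈ z z⊥) (b∈ps z z⊥ps))

  extendRealization : ∀ {m R x₁ y₁ x₂ y₂} {ps : Vec (Pair n) R} {g : V (suc m) → Bool} → IsQuadratic g →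
                      Hyperbolic f ((x₁ , y₁) ∷ (x₂ , y₂) ∷ ps) → Realization f ps (λ u → g (false ∷ u)) →
                      Realization f ((x₁ , y₁) ∷ (x₂ , y₂) ∷ ps) g
  extendRealization {y₁ = y₁} {g = g} qg h@(cons _ _ (_ ∷ y₁⊥ps) _) r
    with nextGenerator h r (g e₀) (λ u → polar g e₀ (false ∷ u)) (λ u u′ → Quadratic.polar-linearʳ qg e₀ (false ∷ u) (false ∷ u′))
  ... | v , fv , vφ′ , y₁v , v∈ = record
    { embedding = φ
    ; restricts = φ-restricts
    ; inSpan    = φ-inSpan
    ; dual      = φ-dual
    }
    where
    φ′ = embedding r
    φ = extend φ′ v (polar f y₁) (polar-linearʳ y₁) (λ u → inSpan r u y₁ y₁⊥ps) y₁v

    φ-restricts : ∀ u → f (fun φ u) ≡ g u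
    φ-restricts (s ∷ u) = begin
      f (s · v ⊕ fun φ′ u)                                             ≡⟨ f-·⊕ s v (fun φ′ u) ⟩
      (s ∧ f v) xor f (fun φ′ u) xor (s ∧ polar f v (fun φ′ u))        ≡⟨ cong₂ (λ x z → (s ∧ x) xor f (fun φ′ u) xor (s ∧ z)) fv (vφ′ u) ⟩
      (s ∧ g e₀) xor f (fun φ′ u) xor (s ∧ polar g e₀ (false ∷ u))     ≡⟨ cong (λ y → (s ∧ g e₀) xor y xor _) (restricts r u) ⟩
      (s ∧ g e₀) xor g (false ∷ u) xor (s ∧ polar g e₀ (false ∷ u))    ≡⟨ Quadratic.f-·⊕ qg s e₀ (false ∷ u) ⟨
      g (s · e₀ ⊕ (false ∷ u))                                         ≡⟨ cong g (·e₀⊕ s u) ⟩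
      g (s ∷ u)                                                        ∎
      where open ≡-Reasoning

    φ-inSpan : ∀ u → InSpan f _ (fun φ u)
    φ-inSpan (s ∷ u) z z⊥@(_ ∷ _ ∷ z⊥ps) =
      trans (linearForm-·⊕ (polar f z) (polar-linearʳ z) s v (fun φ′ u))
            (cong₂ _xor_ (∧false s (v∈ z z⊥)) (inSpan r u z z⊥ps))

    φ-dual : ∀ μ → IsLinearForm μ → ∃ λ b → InSpan f _ b × ∀ u → polar f b (fun φ u) ≡ μ u
    φ-dual μ μ-linear with dual r (λ u → μ (false ∷ u)) (λ u u′ → μ-linear (false ∷ u) (false ∷ u′))
    ... | b , b∈ps , bφ′ = b ⊕ β · y₁ , b′∈ , b′φ
      where
      β = μ e₀ xor polar f b v

      polar-b′ : ∀ w → polar f (b ⊕ β · y₁) w ≡ polar f b w xor (β ∧ polar f y₁ w)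
      polar-b′ w = trans (polar-linearˡ w b (β · y₁)) (cong (polar f b w xor_) (polar-·ˡ β y₁ w))

      b′∈ : InSpan f _ (b ⊕ β · y₁)
      b′∈ z z⊥@((_ , zy₁) ∷ _ ∷ z⊥ps) =
        trans (polar-linearʳ z b (β · y₁))
              (cong₂ _xor_ (b∈ps z z⊥ps) (trans (linearForm-· (polar f z) (polar-linearʳ z) β y₁) (∧false β zy₁)))

      b′v : polar f (b ⊕ β · y₁) v ≡ μ e₀
      b′v = trans (polar-b′ v) (trans (cong (λ x → polar f b v xor (β ∧ x)) y₁v) (cancel (μ e₀) (polar f b v)))
        where
        cancel : ∀ μ₀ p → p xor ((μ₀ xor p) ∧ true) ≡ μ₀
        cancel true  true  = refl
        cancel true  false = refl
        cancel false true  = refl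
        cancel false false = refl

      b′φ′ : ∀ u → polar f (b ⊕ β · y₁) (fun φ′ u) ≡ μ (false ∷ u)
      b′φ′ u = trans (polar-b′ (fun φ′ u))
                     (trans (cong₂ _xor_ (bφ′ u) (∧false β (inSpan r u y₁ y₁⊥ps))) (xor-identityʳ _))

      b′φ : ∀ u → polar f (b ⊕ β · y₁) (fun φ u) ≡ μ u
      b′φ (s ∷ u) = begin
        polar f (b ⊕ β · y₁) (s · v ⊕ fun φ′ u)
          ≡⟨ linearForm-·⊕ (polar f (b ⊕ β · y₁)) (polar-linearʳ _) s v (fun φ′ u) ⟩
        (s ∧ polar f (b ⊕ β · y₁) v) xor polar f (b ⊕ β · y₁) (fun φ′ u)
          ≡⟨ cong₂ (λ x y → (s ∧ x) xor y) b′v (b′φ′ u) ⟩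
        (s ∧ μ e₀) xor μ (false ∷ u)
          ≡⟨ linearForm-∷ μ μ-linear s u ⟨
        μ (s ∷ u) ∎
        where open ≡-Reasoning

realize : ∀ m {n} {f : V n → Bool} → IsQuadratic f → {ps : Vec (Pair n) (m * 2)} → Hyperbolic f ps →
          {g : V m → Bool} → IsQuadratic g → Realization f ps g
realize zero {n} {f} q [] {g} qg = record
  { embedding = record { fun = λ _ → 𝟘 n ; linear = λ _ _ → sym (⊕-same (𝟘 n)) ; inj = λ { [] [] _ → refl } }
  ; restricts = λ { [] → trans (IsQuadratic.vanishes-𝟘 q) (sym (IsQuadratic.vanishes-𝟘 qg)) }
  ; inSpan    = λ _ z _ → polar-𝟘ʳ f (IsQuadratic.vanishes-𝟘 q) z
  ; dual      = λ μ μ-linear → 𝟘 n , (λ z _ → polar-𝟘ʳ f (IsQuadratic.vanishes-𝟘 q) z) ,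
                               λ { [] → trans (polar-𝟘ʳ f (IsQuadratic.vanishes-𝟘 q) (𝟘 n)) (sym (linearForm-𝟘 μ μ-linear)) }
  }
realize (suc m) q h@(cons _ _ _ (cons _ _ _ hps)) qg =
  extendRealization q qg h (realize m q hps (IsQuadratic-∘ qg {λ u → false ∷ u} (λ _ _ → refl)))

critical≤codim : ∀ M {c k} → IsCriticalNumber M c → CodimFree M k → c ≤ k
critical≤codim M {c} {k} (_ , minimal) free with c ≤? k
... | yes c≤k = c≤k
... | no  c≰k = ⊥-elim (minimal k (≰⇒> c≰k) free)

vanishingFlat⇒codimFree : ∀ M {k} → VanishingFlat (E M) k → CodimFree M k
vanishingFlat⇒codimFree M (d , d+k≡n , φ , vanishes) = d , d+k≡n , φ , λ x _ → vanishes x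

realization⇒inducedRestriction : ∀ M N {R} {ps : Vec (Pair (dim M)) R} → Realization (E M) ps (E N) → InducedRestriction N M
realization⇒inducedRestriction M N r = Realization.embedding r , λ x _ → sym (Realization.restricts r x)

theorem1p7 : (𝓜 : MatroidClass) → ProperSubclassOfE3 𝓜 → ClosedUnderInducedRestriction 𝓜 →
    Σ ℕ λ k → ∀ (M : Matroid) → 𝓜 M → ∀ (c : ℕ) → IsCriticalNumber M c → c ≤ k
theorem1p7 𝓜 (𝓜⊆𝓔₃ , N , N∈𝓔₃ , N∉𝓜) closed = suc (dim N * 2 * 2) , χ≤
  where
  χ≤ : ∀ M → 𝓜 M → ∀ c → IsCriticalNumber M c → c ≤ suc (dim N * 2 * 2)
  χ≤ M M∈𝓜 c χ≡c = bound (dichotomy (dim N * 2) M-quadratic)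
    where
    M-quadratic = E3⇒quadratic M (𝓜⊆𝓔₃ M M∈𝓜)

    bound : HyperbolicFamily (E M) (dim N * 2) ⊎ ∃ (λ k → k ≤ suc (dim N * 2 * 2) × VanishingFlat (E M) k) →
            c ≤ suc (dim N * 2 * 2)
    bound (inj₁ (_ , hyperbolic)) = ⊥-elim (N∉𝓜 (closed M N M∈𝓜 N↪M))
      where
      N↪M = realization⇒inducedRestriction M N (realize (dim N) M-quadratic hyperbolic (E3⇒quadratic N N∈𝓔₃))
    bound (inj₂ (k , k≤ , flat)) = ≤-trans (critical≤codim M χ≡c (vanishingFlat⇒codimFree M flat)) k≤
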